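{- Let $X$ be an orientable map. The following are equivalent: (i) $U^2=I$; (ii) $PQ=|\mathcal A|^{ -1}J_{\mathcal A\times\mathcal A}$; (iii) $C=|\mathcal A|^{ -1}DJ_{V\times F}\Delta$; (iv) $\hat C\hat C^T=|\mathcal A|^{ -1}D^{1/2}J_{V\times V}D^{1/2}$; (v) for every vertex $v$ and every face $f$, the vertex $v$ is traversed exactly $|\mathcal A|^{ -1}d(v)d(f)$ times by the facial walk of $f$, where $d(v)$ is the degree of $v$ and $d(f)$ the degree of $f$.
   Context: An orientable map $X$ is a 2-cell embedding of a finite connected multigraph (loops and parallel edges allowed) in a closed orientable surface, with vertex set $V$ and face set $F$. Each edge gives two arcs on opposite sides of it, pointing in opposite directions, each lying in a face and oriented along its clockwise facial walk. Let $\mathcal A$ be the arc set, $v(a)$ the tail vertex and $f(a)$ the face of arc $a$; $N\in\{0,1\}^{\mathcal A\times V}$ with $N(a,w)=1$ iff $w=v(a)$; $M\in\{0,1\}^{\mathcal A\times F}$ with $M(a,f)=1$ iff $f=f(a)$; $D=N^TN$ and $\Delta=M^TM$ are the diagonal matrices of vertex degrees and face degrees; $\hat N=ND^{ -1/2}$, $\hat M=M\Delta^{ -1/2}$, $Q=\hat N\hat N^T$, $P=\hat M\hat M^T$, $U=(2P-I)(2Q-I)$. $C=N^TM$ is the vertex-face incidence matrix ($C(v,f)$ is the number of times $v$ appears on the facial walk of $f$) and $\hat C=\hat N^T\hat M=D^{ -1/2}C\Delta^{ -1/2}$. $J_{A\times B}$ is the all-ones matrix with rows indexed by $A$ and columns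 by $B$. -}

module Defs where

open import Data.Nat using (ℕ; zero; suc)
open import Data.Integer using (+_)
open import Data.Fin using (Fin; zero; suc) renaming (_≟_ to _≟ᶠ_)
open import Data.Rational using (ℚ; 0ℚ; 1ℚ; _+_; _*_; _-_; 1/_; _/_; ≢-nonZero)
open import Data.Rational.Properties using (_≟_)
open import Data.Bool using (Bool; true; false; if_then_else_)
open import Data.List using (List; []; _∷_; foldr)
open import Data.Product using (Σ; ∃; _×_; _,_)
open import Function using (_∘_; _⇔_)
open import Relation.Nullary using (¬_; yes; no)
open import Relation.Nullary.Decidable using (⌊_⌋)
open import Relation.Binary.PropositionalEquality using (_≡_)

iter : ∀ {A : Set} → ℕ → (A → A) → A → A
iter zero    g x = x
iter (suc k) g x = g (iter k g x)

applyWord : ∀ {A : Set} → (A → A) → (A → A) → List Bool → A → A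
applyWord g h w x = foldr (λ b y → if b then g y else h y) x w

ℕ→ℚ : ℕ → ℚ
ℕ→ℚ n = + n / 1

-- total inverse on ℚ (only ever applied to positive numbers below)
inv : ℚ → ℚ
inv p with p ≟ 0ℚ
... | yes _ = 0ℚ
... | no p≢0 = 1/_ p {{≢-nonZero p≢0}}

sumF : ∀ {n} → (Fin n → ℚ) → ℚ
sumF {zero}  f = 0ℚ
sumF {suc n} f = f zero + sumF (f ∘ suc)

countF : ∀ {n} → (Fin n → Bool) → ℕ
countF {zero}  p = 0
countF {suc n} p = (if p zero then 1 else 0) Data.Nat.+ countF (p ∘ suc)

Mat : ℕ → ℕ → Set
Mat m n = Fin m → Fin n → ℚ

_≋_ : ∀ {m n} → Mat m n → Mat m n → Set
A ≋ B = ∀ i j → A i j ≡ B i j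

infix 4 _≋_

_·_ : ∀ {m n k} → Mat m n → Mat n k → Mat m k
(A · B) i j = sumF (λ l → A i l * B l j)

infixl 7 _·_

_ᵀ : ∀ {m n} → Mat m n → Mat n m
(A ᵀ) i j = A j i

_⊕_ : ∀ {m n} → Mat m n → Mat m n → Mat m n
(A ⊕ B) i j = A i j + B i j

_⊖_ : ∀ {m n} → Mat m n → Mat m n → Mat m n
(A ⊖ B) i j = A i j - B i j

_⊛_ : ∀ {m n} → ℚ → Mat m n → Mat m n
(c ⊛ A) i j = c * A i j

infixl 6 _⊕_ _⊖_
infixr 8 _⊛_

I : ∀ {n} → Mat n n
I i j = if ⌊ i ≟ᶠ j ⌋ then 1ℚ else 0ℚ

Jm : ∀ {m n} → Mat m n
Jm i j = 1ℚ

diagInv : ∀ {n} → Mat n n → Mat n n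
diagInv A i j = if ⌊ i ≟ᶠ j ⌋ then inv (A i i) else 0ℚ

-- Orientable maps, combinatorially: arcs Fin nA, rotation σ around
-- vertices, arc reversal θ (fixed-point-free involution), faces = orbits
-- of φ = σ ∘ θ (the successor of an arc along its facial walk).

record OrientableMap : Set where
  field
    nA nV nF : ℕ
    σ σ⁻¹ θ  : Fin nA → Fin nA
    σ-σ⁻¹    : ∀ a → σ (σ⁻¹ a) ≡ a
    σ⁻¹-σ    : ∀ a → σ⁻¹ (σ a) ≡ a
    θ-invol  : ∀ a → θ (θ a) ≡ a
    θ-fpf    : ∀ a → ¬ (θ a ≡ a)
    vert     : Fin nA → Fin nV      -- tail vertex v(a)
    face     : Fin nA → Fin nF
    vert-surj : ∀ w → ∃ λ a → vert a ≡ w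
    face-surj : ∀ f → ∃ λ a → face a ≡ f
    vert-orbit : ∀ a b → (vert a ≡ vert b) ⇔ (∃ λ k → iter k σ a ≡ b)
    face-orbit : ∀ a b → (face a ≡ face b) ⇔ (∃ λ k → iter k (σ ∘ θ) a ≡ b)
    connected  : ∀ a b → ∃ λ w → applyWord σ θ w a ≡ b

module MapMatrices (X : OrientableMap) where
  open OrientableMap X

  N : Mat nA nV
  N a w = if ⌊ vert a ≟ᶠ w ⌋ then 1ℚ else 0ℚ

  M : Mat nA nF
  M a f = if ⌊ face a ≟ᶠ f ⌋ then 1ℚ else 0ℚ

  D : Mat nV nV
  D = N ᵀ · N

  Δ : Mat nF nF
  Δ = M ᵀ · M

  -- Q = N̂ N̂ᵀ = N D^{-1} Nᵀ,  P = M̂ M̂ᵀ = M Δ^{-1} Mᵀ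
  Q : Mat nA nA
  Q = N · diagInv D · N ᵀ

  P : Mat nA nA
  P = M · diagInv Δ · M ᵀ

  two : ℚ
  two = ℕ→ℚ 2

  U : Mat nA nA
  U = (two ⊛ P ⊖ I) · (two ⊛ Q ⊖ I)

  C : Mat nV nF
  C = N ᵀ · M

  invA : ℚ
  invA = inv (ℕ→ℚ nA)

  degV : Fin nV → ℕ
  degV v = countF (λ a → ⌊ vert a ≟ᶠ v ⌋)

  degF : Fin nF → ℕ
  degF f = countF (λ a → ⌊ face a ≟ᶠ f ⌋)

  traversals : Fin nV → Fin nF → ℕ
  traversals v f = countF (λ a → ⌊ vert a ≟ᶠ v ⌋ Data.Bool.∧ ⌊ face a ≟ᶠ f ⌋)

  cond-i : Set
  cond-i = U · U ≋ I

  cond-ii : Set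
  cond-ii = P · Q ≋ invA ⊛ Jm

  cond-iii : Set
  cond-iii = C ≋ invA ⊛ (D · Jm · Δ)

  -- Ĉ Ĉᵀ = D^{-1/2} C Δ^{-1} Cᵀ D^{-1/2} = |A|^{-1} D^{1/2} J D^{1/2},
  -- conjugated by the invertible diagonal D^{1/2}
  cond-iv : Set
  cond-iv = C · diagInv Δ · C ᵀ ≋ invA ⊛ (D · Jm · D)

  cond-v : Set
  cond-v = ∀ v f → ℕ→ℚ (traversals v f) ≡ invA * ℕ→ℚ (degV v) * ℕ→ℚ (degF f)

-- P and Q are the orthogonal projections onto the functions on arcs that are constant on
-- faces, resp. on vertices. Hence 2P − I and 2Q − I are involutions, and U² = I iff P and Q
-- commute. The entry (PQ)(a,b) is C(v(b),f(a)) / (d(f(a)) d(v(b))) and (QP)(a,b) = (PQ)(b,a),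
-- so when P and Q commute, a ↦ (PQ)(a,b) depends only on the face of a and only on the vertex
-- of a; by connectivity it is constant, and its column sum 1 makes it 1/|A|, which is (ii).
-- Conditions (ii), (iii) and (v) are entrywise restatements of C(v,f) = d(v) d(f) / |A|.
-- Finally (iv) evaluated at (v,v) says Σ_f C(v,f)² / d(f) = (Σ_f C(v,f))² / Σ_f d(f), the
-- equality case of Cauchy–Schwarz, which forces C(v,·) to be proportional to d.
module Submission where

open import Defs
open import Algebra.Bundles using (AbelianGroup; CommutativeRing; Monoid)
import Algebra.Properties.Group as GroupProperties
import Algebra.Properties.Monoid as MonoidProperties
import Algebra.Properties.Semiring.Sum as SemiringSum
open import Data.Bool using (Bool; true; false; if_then_else_; _∧_)
open import Data.Fin using (Fin; zero; suc) renaming (_≟_ to _≟ᶠ_)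
open import Data.Integer.Properties using (+◃n≡+n)
open import Data.List using ([]; _∷_)
open import Data.Nat using (ℕ; zero; suc)
import Data.Nat.Coprimality as Coprime
import Data.Nat.Properties as ℕ
open import Data.Product using (_×_; _,_; ∃; proj₁)
open import Data.Sum using (inj₁; inj₂)
open import Data.Rational
  using (ℚ; 0ℚ; 1ℚ; _+_; _*_; _-_; _≤_; _<_; 1/_; ≢-nonZero; positive; nonNegative; nonPositive)
open import Data.Rational.Properties
open import Function using (_∘_; _⇔_; mk⇔; Equivalence)
open import Function.Construct.Composition using (_⇔-∘_)
open import Function.Construct.Symmetry using (⇔-sym)
open import Relation.Nullary using (yes; no; contradiction)
open import Relation.Nullary.Decidable using (⌊_⌋; dec⇒maybe; dec-true; isYes≗does)
open import Relation.Binary.PropositionalEquality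
  using (_≡_; _≢_; refl; sym; trans; cong; cong₂; subst₂; module ≡-Reasoning)
open import Tactic.RingSolver using (solve-∀)
import Tactic.RingSolver.Core.AlmostCommutativeRing as ACR

module _ {c ℓ} (M : Monoid c ℓ) where
  open Monoid M using (_≈_; _∙_; ε; setoid; assoc; identityˡ; ∙-congˡ; ∙-congʳ)
  open MonoidProperties M using (cancelᶜ; elimʳ)
  open import Relation.Binary.Reasoning.Setoid setoid

  involutions-product-involutive⇔comm : ∀ {x y} → x ∙ x ≈ ε → y ∙ y ≈ ε →
                                        ((x ∙ y) ∙ (x ∙ y) ≈ ε) ⇔ (x ∙ y ≈ y ∙ x)
  involutions-product-involutive⇔comm {x} {y} xx≈ε yy≈ε = mk⇔ to from
    where
    to : (x ∙ y) ∙ (x ∙ y) ≈ ε → x ∙ y ≈ y ∙ x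
    to xyxy≈ε = begin
      x ∙ y                          ≈⟨ elimʳ xx≈ε (x ∙ y) ⟨
      (x ∙ y) ∙ (x ∙ x)              ≈⟨ ∙-congˡ (cancelᶜ yy≈ε x x) ⟨
      (x ∙ y) ∙ ((x ∙ y) ∙ (y ∙ x))  ≈⟨ assoc (x ∙ y) (x ∙ y) (y ∙ x) ⟨
      ((x ∙ y) ∙ (x ∙ y)) ∙ (y ∙ x)  ≈⟨ ∙-congʳ xyxy≈ε ⟩
      ε ∙ (y ∙ x)                    ≈⟨ identityˡ (y ∙ x) ⟩
      y ∙ x                          ∎
    from : x ∙ y ≈ y ∙ x → (x ∙ y) ∙ (x ∙ y) ≈ ε
    from xy≈yx = begin
      (x ∙ y) ∙ (x ∙ y)  ≈⟨ ∙-congˡ xy≈yx ⟩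
      (x ∙ y) ∙ (y ∙ x)  ≈⟨ cancelᶜ yy≈ε x x ⟩
      x ∙ x              ≈⟨ xx≈ε ⟩
      ε                  ∎

open ≡-Reasoning
open GroupProperties (AbelianGroup.group +-0-abelianGroup) using ()
  renaming (∙-cancelʳ to +-cancelʳ; x∙y⁻¹≈ε⇒x≈y to x-y≡0⇒x≡y)

private
  ℚ-ring : ACR.AlmostCommutativeRing _ _
  ℚ-ring = ACR.fromCommutativeRing +-*-commutativeRing (λ x → dec⇒maybe (0ℚ ≟ x))

ℕ→ℚ-suc : ∀ n → ℕ→ℚ (suc n) ≡ 1ℚ + ℕ→ℚ n
ℕ→ℚ-suc n rewrite normalize-coprime (Coprime.sym (Coprime.1-coprimeTo n))
  | ℕ.*-identityʳ n | +◃n≡+n n = refl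

ℕ→ℚ-pos : ∀ n → 0ℚ < ℕ→ℚ (suc n)
ℕ→ℚ-pos n = positive⁻¹ (ℕ→ℚ (suc n)) {{normalize-pos (suc n) 1}}

pos⇒≢0 : ∀ {p} → 0ℚ < p → p ≢ 0ℚ
pos⇒≢0 0<p p≡0 = <-irrefl (sym p≡0) 0<p

ℕ→ℚ-≢0 : ∀ {n} → Fin n → ℕ→ℚ n ≢ 0ℚ
ℕ→ℚ-≢0 {suc n} _ = pos⇒≢0 (ℕ→ℚ-pos n)

inv-inverseʳ : ∀ {p} → p ≢ 0ℚ → p * inv p ≡ 1ℚ
inv-inverseʳ {p} p≢0 with p ≟ 0ℚ
... | yes p≡0 = contradiction p≡0 p≢0
... | no p≢0  = *-inverseʳ p {{≢-nonZero p≢0}}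

inv-inverseˡ : ∀ {p} → p ≢ 0ℚ → inv p * p ≡ 1ℚ
inv-inverseˡ {p} p≢0 = trans (*-comm (inv p) p) (inv-inverseʳ p≢0)

inv-nonNeg : ∀ {p} → 0ℚ < p → 0ℚ ≤ inv p
inv-nonNeg {p} 0<p with p ≟ 0ℚ
... | yes _   = ≤-refl
... | no p≢0 = nonNegative⁻¹ p⁻¹ {{pos⇒nonNeg p⁻¹ {{1/pos⇒pos p {{positive 0<p}}}}}}
  where p⁻¹ = (1/ p) {{≢-nonZero p≢0}}

*-cancelˡ-≢0 : ∀ {c x y} → c ≢ 0ℚ → c * x ≡ c * y → x ≡ y
*-cancelˡ-≢0 {c} {x} {y} c≢0 cx≡cy = begin
  x                ≡⟨ *-identityˡ x ⟨
  1ℚ * x           ≡⟨ cong (_* x) (inv-inverseˡ c≢0) ⟨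
  inv c * c * x    ≡⟨ *-assoc (inv c) c x ⟩
  inv c * (c * x)  ≡⟨ cong (inv c *_) cx≡cy ⟩
  inv c * (c * y)  ≡⟨ *-assoc (inv c) c y ⟨
  inv c * c * y    ≡⟨ cong (_* y) (inv-inverseˡ c≢0) ⟩
  1ℚ * y           ≡⟨ *-identityˡ y ⟩
  y                ∎

*≡1⇒≡inv : ∀ {p q} → p * q ≡ 1ℚ → q ≡ inv p
*≡1⇒≡inv {p} {q} pq≡1 = *-cancelˡ-≢0 p≢0 (trans pq≡1 (sym (inv-inverseʳ p≢0)))
  where
  p≢0 : p ≢ 0ℚ
  p≢0 p≡0 with trans (sym pq≡1) (trans (cong (_* q) p≡0) (*-zeroˡ q))
  ... | ()

square≡0⇒≡0 : ∀ x → x * x ≡ 0ℚ → x ≡ 0ℚ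
square≡0⇒≡0 x xx≡0 with x ≟ 0ℚ
... | yes x≡0 = x≡0
... | no x≢0  = *-cancelˡ-≢0 x≢0 (trans xx≡0 (sym (*-zeroʳ x)))

square-nonNeg : ∀ x → 0ℚ ≤ x * x
square-nonNeg x with ≤-total 0ℚ x
... | inj₁ 0≤x = nonNegative⁻¹ _ {{nonNeg*nonNeg⇒nonNeg x {{nonNegative 0≤x}} x {{nonNegative 0≤x}}}}
... | inj₂ x≤0 = nonNegative⁻¹ _ {{nonPos*nonPos⇒nonPos x {{nonPositive x≤0}} x {{nonPositive x≤0}}}}

nonNeg+nonNeg≡0 : ∀ {p q} → 0ℚ ≤ p → 0ℚ ≤ q → p + q ≡ 0ℚ → p ≡ 0ℚ × q ≡ 0ℚ
nonNeg+nonNeg≡0 {p} {q} 0≤p 0≤q p+q≡0 = ≤-antisym p≤0 0≤p , ≤-antisym q≤0 0≤q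
  where
  p≤0 : p ≤ 0ℚ
  p≤0 = subst₂ _≤_ (+-identityʳ p) p+q≡0 (+-monoʳ-≤ p 0≤q)
  q≤0 : q ≤ 0ℚ
  q≤0 = subst₂ _≤_ (+-identityˡ q) p+q≡0 (+-monoˡ-≤ q 0≤p)

open SemiringSum (CommutativeRing.semiring +-*-commutativeRing)
  using (sum; sum-cong-≗; ∑-distrib-+; ∑-comm; *-distribˡ-sum; *-distribʳ-sum)

sumF≡sum : ∀ {n} (f : Fin n → ℚ) → sumF f ≡ sum f
sumF≡sum {zero} f = refl
sumF≡sum {suc n} f = cong (f zero +_) (sumF≡sum (f ∘ suc))

sumF-cong : ∀ {n} {f g : Fin n → ℚ} → (∀ i → f i ≡ g i) → sumF f ≡ sumF g
sumF-cong {f = f} {g} f≗g = begin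
  sumF f  ≡⟨ sumF≡sum f ⟩
  sum f   ≡⟨ sum-cong-≗ f≗g ⟩
  sum g   ≡⟨ sumF≡sum g ⟨
  sumF g  ∎

sumF-distrib-+ : ∀ {n} (f g : Fin n → ℚ) → sumF (λ i → f i + g i) ≡ sumF f + sumF g
sumF-distrib-+ f g = begin
  sumF (λ i → f i + g i)  ≡⟨ sumF≡sum (λ i → f i + g i) ⟩
  sum (λ i → f i + g i)   ≡⟨ ∑-distrib-+ f g ⟩
  sum f + sum g           ≡⟨ cong₂ _+_ (sumF≡sum f) (sumF≡sum g) ⟨
  sumF f + sumF g         ∎

*-distribˡ-sumF : ∀ {n} c (f : Fin n → ℚ) → c * sumF f ≡ sumF (λ i → c * f i)
*-distribˡ-sumF c f = begin
  c * sumF f               ≡⟨ cong (c *_) (sumF≡sum f) ⟩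
  c * sum f                ≡⟨ *-distribˡ-sum c f ⟩
  sum (λ i → c * f i)      ≡⟨ sumF≡sum (λ i → c * f i) ⟨
  sumF (λ i → c * f i)     ∎

*-distribʳ-sumF : ∀ {n} c (f : Fin n → ℚ) → sumF f * c ≡ sumF (λ i → f i * c)
*-distribʳ-sumF c f = begin
  sumF f * c               ≡⟨ cong (_* c) (sumF≡sum f) ⟩
  sum f * c                ≡⟨ *-distribʳ-sum c f ⟩
  sum (λ i → f i * c)      ≡⟨ sumF≡sum (λ i → f i * c) ⟨
  sumF (λ i → f i * c)     ∎

sumF-comm : ∀ {m n} (f : Fin m → Fin n → ℚ) →
            sumF (λ i → sumF (f i)) ≡ sumF (λ j → sumF (λ i → f i j))
sumF-comm f = begin
  sumF (λ i → sumF (f i))            ≡⟨ sumF-cong (λ i → sumF≡sum (f i)) ⟩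
  sumF (λ i → sum (f i))             ≡⟨ sumF≡sum (λ i → sum (f i)) ⟩
  sum (λ i → sum (f i))              ≡⟨ ∑-comm f ⟩
  sum (λ j → sum (λ i → f i j))      ≡⟨ sumF≡sum (λ j → sum (λ i → f i j)) ⟨
  sumF (λ j → sum (λ i → f i j))     ≡⟨ sumF-cong (λ j → sumF≡sum (λ i → f i j)) ⟨
  sumF (λ j → sumF (λ i → f i j))    ∎

sumF-const : ∀ {n} c → sumF {n} (λ _ → c) ≡ ℕ→ℚ n * c
sumF-const {zero} c = sym (*-zeroˡ c)
sumF-const {suc n} c = begin
  c + sumF {n} (λ _ → c)   ≡⟨ cong (c +_) (sumF-const {n} c) ⟩
  c + ℕ→ℚ n * c            ≡⟨ cong (_+ ℕ→ℚ n * c) (*-identityˡ c) ⟨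
  1ℚ * c + ℕ→ℚ n * c       ≡⟨ *-distribʳ-+ c 1ℚ (ℕ→ℚ n) ⟨
  (1ℚ + ℕ→ℚ n) * c         ≡⟨ cong (_* c) (ℕ→ℚ-suc n) ⟨
  ℕ→ℚ (suc n) * c          ∎

sumF-count : ∀ {n} (p : Fin n → Bool) → sumF (λ i → if p i then 1ℚ else 0ℚ) ≡ ℕ→ℚ (countF p)
sumF-count {zero} p = refl
sumF-count {suc n} p with p zero
... | true  = trans (cong (1ℚ +_) (sumF-count (p ∘ suc))) (sym (ℕ→ℚ-suc (countF (p ∘ suc))))
... | false = trans (+-identityˡ _) (sumF-count (p ∘ suc))

sumF-zero : ∀ {n} → sumF {n} (λ _ → 0ℚ) ≡ 0ℚ
sumF-zero {n} = trans (sumF-const {n} 0ℚ) (*-zeroʳ (ℕ→ℚ n))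

indicator-∧ : ∀ b c → (if b then 1ℚ else 0ℚ) * (if c then 1ℚ else 0ℚ) ≡ (if b ∧ c then 1ℚ else 0ℚ)
indicator-∧ true  c = *-identityˡ (if c then 1ℚ else 0ℚ)
indicator-∧ false c = *-zeroˡ (if c then 1ℚ else 0ℚ)

countF-suc : ∀ {n} (p : Fin n → Bool) i → p i ≡ true → ∃ λ c → countF p ≡ suc c
countF-suc p zero    p₀≡true rewrite p₀≡true = countF (p ∘ suc) , refl
countF-suc p (suc i) pᵢ≡true with countF-suc (p ∘ suc) i pᵢ≡true
... | c , count≡suc rewrite count≡suc = _ , ℕ.+-suc _ c

sumF-nonNeg : ∀ {n} (f : Fin n → ℚ) → (∀ i → 0ℚ ≤ f i) → 0ℚ ≤ sumF f
sumF-nonNeg {zero} f 0≤f = ≤-refl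
sumF-nonNeg {suc n} f 0≤f = +-mono-≤ (0≤f zero) (sumF-nonNeg (f ∘ suc) (0≤f ∘ suc))

sumF-nonNeg-≡0 : ∀ {n} (f : Fin n → ℚ) → (∀ i → 0ℚ ≤ f i) → sumF f ≡ 0ℚ → ∀ i → f i ≡ 0ℚ
sumF-nonNeg-≡0 {suc n} f 0≤f Σf≡0 i
  with nonNeg+nonNeg≡0 (0≤f zero) (sumF-nonNeg (f ∘ suc) (0≤f ∘ suc)) Σf≡0
sumF-nonNeg-≡0 f 0≤f Σf≡0 zero    | f₀≡0 , _ = f₀≡0
sumF-nonNeg-≡0 f 0≤f Σf≡0 (suc i) | _ , Σtail≡0 = sumF-nonNeg-≡0 (f ∘ suc) (0≤f ∘ suc) Σtail≡0 i

square-deviation : ∀ x c d i → d * i ≡ 1ℚ →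
                   (x - c * d) * (x - c * d) * i + (c * x + c * x) ≡ x * x * i + c * (c * d)
square-deviation x c d i d*i≡1 = begin
  e² + 2cx                     ≡⟨ cong (e² +_) (*-identityʳ 2cx) ⟨
  e² + 2cx * 1ℚ                ≡⟨ cong (λ k → e² + 2cx * k) d*i≡1 ⟨
  e² + 2cx * (d * i)           ≡⟨ expand x c d i ⟩
  x * x * i + c²d * (d * i)    ≡⟨ cong (λ k → x * x * i + c²d * k) d*i≡1 ⟩
  x * x * i + c²d * 1ℚ         ≡⟨ cong (x * x * i +_) (*-identityʳ c²d) ⟩
  x * x * i + c²d              ∎
  where
  e²  = (x - c * d) * (x - c * d) * i
  2cx = c * x + c * x
  c²d = c * (c * d)
  expand : ∀ x c d i → (x - c * d) * (x - c * d) * i + (c * x + c * x) * (d * i)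
                       ≡ x * x * i + c * (c * d) * (d * i)
  expand = solve-∀ ℚ-ring

-- Equality case of Cauchy–Schwarz (Σ x)² ≤ (Σ x² / d) (Σ d), with c = Σ x / Σ d.
sumF-square-tight⇒proportional : ∀ {n} (x d : Fin n → ℚ) c → (∀ g → 0ℚ < d g) →
  sumF (λ g → x g * x g * inv (d g)) ≡ c * sumF x → c * sumF d ≡ sumF x →
  ∀ g → x g ≡ c * d g
sumF-square-tight⇒proportional x d c d-pos Σx²/d≡cΣx cΣd≡Σx g =
  x-y≡0⇒x≡y (x g) (c * d g) (square≡0⇒≡0 (e g) (begin
    e g * e g                      ≡⟨ *-identityʳ (e g * e g) ⟨
    e g * e g * 1ℚ                 ≡⟨ cong (e g * e g *_) (inv-inverseˡ (pos⇒≢0 (d-pos g))) ⟨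
    e g * e g * (inv (d g) * d g)  ≡⟨ *-assoc (e g * e g) (inv (d g)) (d g) ⟨
    T g * d g                      ≡⟨ cong (_* d g) (sumF-nonNeg-≡0 T T-nonNeg ΣT≡0 g) ⟩
    0ℚ * d g                       ≡⟨ *-zeroˡ (d g) ⟩
    0ℚ                             ∎))
  where
  e = λ g → x g - c * d g
  T = λ g → e g * e g * inv (d g)
  cΣx = c * sumF x
  T-nonNeg : ∀ g → 0ℚ ≤ T g
  T-nonNeg g = nonNegative⁻¹ (T g) {{nonNeg*nonNeg⇒nonNeg (e g * e g) {{nonNegative (square-nonNeg (e g))}}
                                                         (inv (d g)) {{nonNegative (inv-nonNeg (d-pos g))}}}}
  Σc²d≡cΣx : sumF (λ g → c * (c * d g)) ≡ cΣx
  Σc²d≡cΣx = begin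
    sumF (λ g → c * (c * d g))  ≡⟨ *-distribˡ-sumF c (λ g → c * d g) ⟨
    c * sumF (λ g → c * d g)    ≡⟨ cong (c *_) (*-distribˡ-sumF c d) ⟨
    c * (c * sumF d)            ≡⟨ cong (c *_) cΣd≡Σx ⟩
    cΣx                         ∎
  ΣT≡0 : sumF T ≡ 0ℚ
  ΣT≡0 = +-cancelʳ (cΣx + cΣx) (sumF T) 0ℚ (begin
    sumF T + (cΣx + cΣx)
      ≡⟨ cong (sumF T +_) (cong₂ _+_ (*-distribˡ-sumF c x) (*-distribˡ-sumF c x)) ⟩
    sumF T + (sumF (λ g → c * x g) + sumF (λ g → c * x g))
      ≡⟨ cong (sumF T +_) (sumF-distrib-+ (λ g → c * x g) (λ g → c * x g)) ⟨
    sumF T + sumF (λ g → c * x g + c * x g)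
      ≡⟨ sumF-distrib-+ T (λ g → c * x g + c * x g) ⟨
    sumF (λ g → T g + (c * x g + c * x g))
      ≡⟨ sumF-cong (λ g → square-deviation (x g) c (d g) (inv (d g)) (inv-inverseʳ (pos⇒≢0 (d-pos g)))) ⟩
    sumF (λ g → x g * x g * inv (d g) + c * (c * d g))
      ≡⟨ sumF-distrib-+ (λ g → x g * x g * inv (d g)) (λ g → c * (c * d g)) ⟩
    sumF (λ g → x g * x g * inv (d g)) + sumF (λ g → c * (c * d g))
      ≡⟨ cong₂ _+_ Σx²/d≡cΣx Σc²d≡cΣx ⟩
    cΣx + cΣx
      ≡⟨ +-identityˡ (cΣx + cΣx) ⟨
    0ℚ + (cΣx + cΣx)  ∎)

I-diag : ∀ {n} (i : Fin n) → I i i ≡ 1ℚ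
I-diag i with i ≟ᶠ i
... | yes _   = refl
... | no i≢i = contradiction refl i≢i

I-off : ∀ {n} {i j : Fin n} → i ≢ j → I i j ≡ 0ℚ
I-off {i = i} {j} i≢j with i ≟ᶠ j
... | yes i≡j = contradiction i≡j i≢j
... | no _    = refl

I-sym : ∀ {n} (i j : Fin n) → I i j ≡ I j i
I-sym i j with i ≟ᶠ j
... | yes refl = sym (I-diag i)
... | no i≢j   = sym (I-off (i≢j ∘ sym))

I-suc : ∀ {n} (i j : Fin n) → I (suc i) (suc j) ≡ I i j
I-suc i j with i ≟ᶠ j
... | yes refl = refl
... | no _     = refl

I-subst : ∀ {n} (i j : Fin n) (f : Fin n → ℚ) → I i j * f i ≡ I i j * f j
I-subst i j f with i ≟ᶠ j
... | yes refl = refl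
... | no _     = trans (*-zeroˡ (f i)) (sym (*-zeroˡ (f j)))

sumF-δˡ : ∀ {n} (i : Fin n) (f : Fin n → ℚ) → sumF (λ l → I i l * f l) ≡ f i
sumF-δˡ {suc n} zero f = begin
  1ℚ * f zero + sumF (λ l → 0ℚ * f (suc l))  ≡⟨ cong₂ _+_ (*-identityˡ (f zero)) (sumF-cong (λ l → *-zeroˡ (f (suc l)))) ⟩
  f zero + sumF {n} (λ _ → 0ℚ)              ≡⟨ cong (f zero +_) (sumF-zero {n}) ⟩
  f zero + 0ℚ                                ≡⟨ +-identityʳ (f zero) ⟩
  f zero                                     ∎
sumF-δˡ {suc n} (suc i) f = begin
  0ℚ * f zero + sumF (λ l → I (suc i) (suc l) * f (suc l))  ≡⟨ cong₂ _+_ (*-zeroˡ (f zero)) (sumF-cong (λ l → cong (_* f (suc l)) (I-suc i l))) ⟩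
  0ℚ + sumF (λ l → I i l * f (suc l))                        ≡⟨ +-identityˡ _ ⟩
  sumF (λ l → I i l * f (suc l))                             ≡⟨ sumF-δˡ i (f ∘ suc) ⟩
  f (suc i)                                                  ∎

sumF-δʳ : ∀ {n} (j : Fin n) (f : Fin n → ℚ) → sumF (λ l → f l * I l j) ≡ f j
sumF-δʳ j f = trans (sumF-cong (λ l → trans (*-comm (f l) (I l j)) (cong (_* f l) (I-sym l j)))) (sumF-δˡ j f)

I-rowSum : ∀ {n} (i : Fin n) → sumF (I i) ≡ 1ℚ
I-rowSum i = trans (sumF-cong (λ l → sym (*-identityʳ (I i l)))) (sumF-δˡ i (λ _ → 1ℚ))

·-cong : ∀ {m n k} {A A′ : Mat m n} {B B′ : Mat n k} → A ≋ A′ → B ≋ B′ → A · B ≋ A′ · B′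
·-cong A≋A′ B≋B′ i j = sumF-cong (λ l → cong₂ _*_ (A≋A′ i l) (B≋B′ l j))

·-assoc : ∀ {m n k r} (A : Mat m n) (B : Mat n k) (C : Mat k r) → (A · B) · C ≋ A · (B · C)
·-assoc A B C i j = begin
  sumF (λ l → sumF (λ p → A i p * B p l) * C l j)    ≡⟨ sumF-cong (λ l → *-distribʳ-sumF (C l j) (λ p → A i p * B p l)) ⟩
  sumF (λ l → sumF (λ p → A i p * B p l * C l j))    ≡⟨ sumF-comm (λ l p → A i p * B p l * C l j) ⟩
  sumF (λ p → sumF (λ l → A i p * B p l * C l j))    ≡⟨ sumF-cong (λ p → sumF-cong (λ l → *-assoc (A i p) (B p l) (C l j))) ⟩
  sumF (λ p → sumF (λ l → A i p * (B p l * C l j)))  ≡⟨ sumF-cong (λ p → *-distribˡ-sumF (A i p) (λ l → B p l * C l j)) ⟨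
  sumF (λ p → A i p * sumF (λ l → B p l * C l j))    ∎

·-identityˡ : ∀ {m n} (A : Mat m n) → I · A ≋ A
·-identityˡ A i j = sumF-δˡ i (λ l → A l j)

·-identityʳ : ∀ {m n} (A : Mat m n) → A · I ≋ A
·-identityʳ A i j = sumF-δʳ j (A i)

squareMonoid : ℕ → Monoid _ _
squareMonoid n = record
  { Carrier  = Mat n n
  ; _≈_      = _≋_
  ; _∙_      = _·_
  ; ε        = I
  ; isMonoid = record
    { isSemigroup = record
      { isMagma = record
        { isEquivalence = record
          { refl  = λ i j → refl
          ; sym   = λ A≋B i j → sym (A≋B i j)
          ; trans = λ A≋B B≋C i j → trans (A≋B i j) (B≋C i j)
          }
        ; ∙-cong = ·-cong
        }
      ; assoc = ·-assoc
      }
    ; identity = ·-identityˡ , ·-identityʳ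
    }
  }

·-colSum : ∀ {m n k} (A : Mat m n) (B : Mat n k) → (∀ l → sumF (λ i → A i l) ≡ 1ℚ) →
           ∀ j → sumF (λ i → (A · B) i j) ≡ sumF (λ l → B l j)
·-colSum A B colSum≡1 j = begin
  sumF (λ i → sumF (λ l → A i l * B l j))  ≡⟨ sumF-comm (λ i l → A i l * B l j) ⟩
  sumF (λ l → sumF (λ i → A i l * B l j))  ≡⟨ sumF-cong (λ l → *-distribʳ-sumF (B l j) (λ i → A i l)) ⟨
  sumF (λ l → sumF (λ i → A i l) * B l j)  ≡⟨ sumF-cong (λ l → trans (cong (_* B l j) (colSum≡1 l)) (*-identityˡ (B l j))) ⟩
  sumF (λ l → B l j)                        ∎

diag : ∀ {n} → (Fin n → ℚ) → Mat n n
diag d i j = d i * I i j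

diag-·ˡ : ∀ {n k} (d : Fin n → ℚ) (A : Mat n k) i j → (diag d · A) i j ≡ d i * A i j
diag-·ˡ d A i j = begin
  sumF (λ l → d i * I i l * A l j)    ≡⟨ sumF-cong (λ l → trans (cong (_* A l j) (*-comm (d i) (I i l))) (*-assoc (I i l) (d i) (A l j))) ⟩
  sumF (λ l → I i l * (d i * A l j))  ≡⟨ sumF-δˡ i (λ l → d i * A l j) ⟩
  d i * A i j                          ∎

·-diagʳ : ∀ {m n} (A : Mat m n) (d : Fin n → ℚ) i j → (A · diag d) i j ≡ A i j * d j
·-diagʳ A d i j = begin
  sumF (λ l → A i l * (d l * I l j))  ≡⟨ sumF-cong (λ l → *-assoc (A i l) (d l) (I l j)) ⟨
  sumF (λ l → A i l * d l * I l j)    ≡⟨ sumF-δʳ j (λ l → A i l * d l) ⟩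
  A i j * d j                          ∎

diag-·-Jm-·-diag : ∀ {m n} (a : Fin m → ℚ) (b : Fin n → ℚ) i j → (diag a · Jm · diag b) i j ≡ a i * b j
diag-·-Jm-·-diag a b i j = trans (·-diagʳ (diag a · Jm) b i j) (cong (_* b j) (trans (diag-·ˡ a Jm i j) (*-identityʳ (a i))))

diagInv-diag : ∀ {n} {A : Mat n n} {d : Fin n → ℚ} → A ≋ diag d → diagInv A ≋ diag (inv ∘ d)
diagInv-diag {A = A} {d} A≋diag i j with i ≟ᶠ j
... | no _     = sym (*-zeroʳ (inv (d i)))
... | yes refl = begin
  inv (A i i)        ≡⟨ cong inv (A≋diag i i) ⟩
  inv (d i * I i i)  ≡⟨ cong (λ δ → inv (d i * δ)) (I-diag i) ⟩
  inv (d i * 1ℚ)     ≡⟨ cong inv (*-identityʳ (d i)) ⟩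
  inv (d i)          ≡⟨ *-identityʳ (inv (d i)) ⟨
  inv (d i) * 1ℚ     ∎

-- Reflections

·-affine : ∀ {n} t (X Y : Mat n n) i j →
           ((t ⊛ X ⊖ I) · (t ⊛ Y ⊖ I)) i j + (t * X i j + t * Y i j) ≡ t * t * (X · Y) i j + I i j
·-affine {n} t X Y i j = begin
  sumF E + (t * X i j + t * Y i j)
    ≡⟨ cong (sumF E +_) (cong₂ _+_ tX tY) ⟨
  sumF E + (sumF (λ l → t * (X i l * I l j)) + sumF (λ l → t * (I i l * Y l j)))
    ≡⟨ cong (sumF E +_) (sumF-distrib-+ {n} _ _) ⟨
  sumF E + sumF (λ l → t * (X i l * I l j) + t * (I i l * Y l j))
    ≡⟨ sumF-distrib-+ E _ ⟨
  sumF (λ l → E l + (t * (X i l * I l j) + t * (I i l * Y l j)))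
    ≡⟨ sumF-cong (λ l → expand t (X i l) (Y l j) (I i l) (I l j)) ⟩
  sumF (λ l → t * t * (X i l * Y l j) + I i l * I l j)
    ≡⟨ sumF-distrib-+ {n} _ _ ⟩
  sumF (λ l → t * t * (X i l * Y l j)) + sumF (λ l → I i l * I l j)
    ≡⟨ cong₂ _+_ (*-distribˡ-sumF (t * t) (λ l → X i l * Y l j)) (sym (sumF-δˡ i (λ l → I l j))) ⟨
  t * t * (X · Y) i j + I i j  ∎
  where
  E = λ l → (t * X i l - I i l) * (t * Y l j - I l j)
  tX : sumF (λ l → t * (X i l * I l j)) ≡ t * X i j
  tX = trans (sym (*-distribˡ-sumF t (λ l → X i l * I l j))) (cong (t *_) (sumF-δʳ j (X i)))
  tY : sumF (λ l → t * (I i l * Y l j)) ≡ t * Y i j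
  tY = trans (sym (*-distribˡ-sumF t (λ l → I i l * Y l j))) (cong (t *_) (sumF-δˡ i (λ l → Y l j)))
  expand : ∀ t x y a b → (t * x - a) * (t * y - b) + (t * (x * b) + t * (a * y)) ≡ t * t * (x * y) + a * b
  expand = solve-∀ ℚ-ring

reflection : ∀ {n} → Mat n n → Mat n n
reflection X = ℕ→ℚ 2 ⊛ X ⊖ I

reflection-involutive : ∀ {n} {X : Mat n n} → X · X ≋ X → reflection X · reflection X ≋ I
reflection-involutive {X = X} X-idem i j = +-cancelʳ (2X i j) _ _ (begin
  (reflection X · reflection X) i j + 2X i j  ≡⟨ ·-affine t X X i j ⟩
  t * t * (X · X) i j + I i j                 ≡⟨ cong (λ z → t * t * z + I i j) (X-idem i j) ⟩
  t * t * X i j + I i j                       ≡⟨⟩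
  (t + t) * X i j + I i j                     ≡⟨ cong (_+ I i j) (*-distribʳ-+ (X i j) t t) ⟩
  2X i j + I i j                              ≡⟨ +-comm (2X i j) (I i j) ⟩
  I i j + 2X i j                              ∎)
  where
  t = ℕ→ℚ 2
  2X = λ i j → t * X i j + t * X i j

reflection-comm⇔comm : ∀ {n} (P Q : Mat n n) →
                       (reflection P · reflection Q ≋ reflection Q · reflection P) ⇔ (P · Q ≋ Q · P)
reflection-comm⇔comm P Q = mk⇔ to from
  where
  t = ℕ→ℚ 2
  s = λ i j → t * P i j + t * Q i j
  RPQ : ∀ i j → (reflection P · reflection Q) i j + s i j ≡ t * t * (P · Q) i j + I i j
  RPQ = ·-affine t P Q
  RQP : ∀ i j → (reflection Q · reflection P) i j + s i j ≡ t * t * (Q · P) i j + I i j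
  RQP i j = trans (cong ((reflection Q · reflection P) i j +_) (+-comm (t * P i j) (t * Q i j))) (·-affine t Q P i j)
  t*t≢0 : t * t ≢ 0ℚ
  t*t≢0 = pos⇒≢0 (ℕ→ℚ-pos 3)  -- t * t computes to ℕ→ℚ 4
  to : reflection P · reflection Q ≋ reflection Q · reflection P → P · Q ≋ Q · P
  to RP-RQ-comm i j = *-cancelˡ-≢0 t*t≢0 (+-cancelʳ (I i j) _ _
    (trans (sym (RPQ i j)) (trans (cong (_+ s i j) (RP-RQ-comm i j)) (RQP i j))))
  from : P · Q ≋ Q · P → reflection P · reflection Q ≋ reflection Q · reflection P
  from PQ≋QP i j = +-cancelʳ (s i j) _ _
    (trans (RPQ i j) (trans (cong (λ z → t * t * z + I i j) (PQ≋QP i j)) (sym (RQP i j))))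

reflection-product-involutive⇔comm : ∀ {n} {P Q : Mat n n} → P · P ≋ P → Q · Q ≋ Q →
  ((reflection P · reflection Q) · (reflection P · reflection Q) ≋ I) ⇔ (P · Q ≋ Q · P)
reflection-product-involutive⇔comm {n} {P} {Q} P-idem Q-idem =
  reflection-comm⇔comm P Q ⇔-∘
  involutions-product-involutive⇔comm (squareMonoid n) {reflection P} {reflection Q} (reflection-involutive P-idem) (reflection-involutive Q-idem)

-- Projections onto the functions that are constant on the fibres of a map

module FibreProjection {m k} (h : Fin m → Fin k) (h-surj : ∀ x → ∃ λ a → h a ≡ x) where

  incidence : Mat m k
  incidence a x = I (h a) x

  deg : Fin k → ℚ
  deg x = ℕ→ℚ (countF (λ a → ⌊ h a ≟ᶠ x ⌋))

  sumF-fibre : ∀ x (F : Fin k → ℚ) → sumF (λ a → I (h a) x * F (h a)) ≡ deg x * F x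
  sumF-fibre x F = begin
    sumF (λ a → I (h a) x * F (h a))  ≡⟨ sumF-cong (λ a → I-subst (h a) x F) ⟩
    sumF (λ a → I (h a) x * F x)      ≡⟨ *-distribʳ-sumF (F x) (λ a → I (h a) x) ⟨
    sumF (λ a → I (h a) x) * F x      ≡⟨ cong (_* F x) (sumF-count (λ a → ⌊ h a ≟ᶠ x ⌋)) ⟩
    deg x * F x                        ∎

  deg-pos : ∀ x → 0ℚ < deg x
  deg-pos x with h-surj x
  ... | a , refl
    with countF-suc (λ b → ⌊ h b ≟ᶠ h a ⌋) a (trans (isYes≗does (h a ≟ᶠ h a)) (dec-true (h a ≟ᶠ h a) refl))
  ...   | c , count≡suc rewrite count≡suc = ℕ→ℚ-pos c

  deg*inv : ∀ x → deg x * inv (deg x) ≡ 1ℚ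
  deg*inv x = inv-inverseʳ (pos⇒≢0 (deg-pos x))

  sumF-deg : sumF deg ≡ ℕ→ℚ m
  sumF-deg = begin
    sumF deg                                  ≡⟨ sumF-cong (λ x → sumF-count (λ a → ⌊ h a ≟ᶠ x ⌋)) ⟨
    sumF (λ x → sumF (λ a → I (h a) x))       ≡⟨ sumF-comm (λ x a → I (h a) x) ⟩
    sumF (λ a → sumF (I (h a)))               ≡⟨ sumF-cong (λ a → I-rowSum (h a)) ⟩
    sumF {m} (λ _ → 1ℚ)                       ≡⟨ sumF-const {m} 1ℚ ⟩
    ℕ→ℚ m * 1ℚ                                ≡⟨ *-identityʳ (ℕ→ℚ m) ⟩
    ℕ→ℚ m                                     ∎

  gram : incidence ᵀ · incidence ≋ diag deg
  gram x y = sumF-fibre x (λ z → I z y)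

  proj : Mat m m
  proj = incidence · diagInv (incidence ᵀ · incidence) · incidence ᵀ

  proj-entry : ∀ a b → proj a b ≡ inv (deg (h a)) * I (h a) (h b)
  proj-entry a b = begin
    proj a b
      ≡⟨ sumF-cong (λ x → cong (_* I (h b) x) (trans (·-cong {A = incidence} (λ _ _ → refl) (diagInv-diag {d = deg} gram) a x)
                                                      (·-diagʳ incidence (inv ∘ deg) a x))) ⟩
    sumF (λ x → I (h a) x * inv (deg x) * I (h b) x)    ≡⟨ sumF-cong (λ x → *-assoc (I (h a) x) (inv (deg x)) (I (h b) x)) ⟩
    sumF (λ x → I (h a) x * (inv (deg x) * I (h b) x))  ≡⟨ sumF-δˡ (h a) (λ x → inv (deg x) * I (h b) x) ⟩
    inv (deg (h a)) * I (h b) (h a)                      ≡⟨ cong (inv (deg (h a)) *_) (I-sym (h b) (h a)) ⟩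
    inv (deg (h a)) * I (h a) (h b)                      ∎

  proj-sym : ∀ a b → proj a b ≡ proj b a
  proj-sym a b = begin
    proj a b                         ≡⟨ proj-entry a b ⟩
    inv (deg (h a)) * I (h a) (h b)  ≡⟨ *-comm (inv (deg (h a))) (I (h a) (h b)) ⟩
    I (h a) (h b) * inv (deg (h a))  ≡⟨ I-subst (h a) (h b) (inv ∘ deg) ⟩
    I (h a) (h b) * inv (deg (h b))  ≡⟨ cong (_* inv (deg (h b))) (I-sym (h a) (h b)) ⟩
    I (h b) (h a) * inv (deg (h b))  ≡⟨ *-comm (I (h b) (h a)) (inv (deg (h b))) ⟩
    inv (deg (h b)) * I (h b) (h a)  ≡⟨ proj-entry b a ⟨
    proj b a                         ∎

  proj-colSum : ∀ b → sumF (λ a → proj a b) ≡ 1ℚ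
  proj-colSum b = begin
    sumF (λ a → proj a b)
      ≡⟨ sumF-cong (λ a → trans (proj-sym a b) (trans (proj-entry b a) (*-comm (inv (deg (h b))) (I (h b) (h a))))) ⟩
    sumF (λ a → I (h b) (h a) * inv (deg (h b)))   ≡⟨ sumF-cong (λ a → cong (_* inv (deg (h b))) (I-sym (h b) (h a))) ⟩
    sumF (λ a → I (h a) (h b) * inv (deg (h b)))   ≡⟨ *-distribʳ-sumF (inv (deg (h b))) (λ a → I (h a) (h b)) ⟨
    sumF (λ a → I (h a) (h b)) * inv (deg (h b))   ≡⟨ cong (_* inv (deg (h b))) (sumF-count (λ a → ⌊ h a ≟ᶠ h b ⌋)) ⟩
    deg (h b) * inv (deg (h b))                    ≡⟨ deg*inv (h b) ⟩
    1ℚ                                             ∎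

  proj-idem : proj · proj ≋ proj
  proj-idem a b = begin
    sumF (λ l → proj a l * proj l b)             ≡⟨ sumF-cong (λ l → cong₂ _*_ (proj-entry a l) (proj-entry l b)) ⟩
    sumF (λ l → iₐ * I (h a) (h l) * F (h l))    ≡⟨ sumF-cong (λ l → cong (λ δ → iₐ * δ * F (h l)) (I-sym (h a) (h l))) ⟩
    sumF (λ l → iₐ * I (h l) (h a) * F (h l))    ≡⟨ sumF-cong (λ l → swap-assoc iₐ (I (h l) (h a)) (F (h l))) ⟩
    sumF (λ l → I (h l) (h a) * (iₐ * F (h l)))  ≡⟨ sumF-fibre (h a) (λ z → iₐ * F z) ⟩
    deg (h a) * (iₐ * F (h a))                   ≡⟨ *-assoc (deg (h a)) iₐ (F (h a)) ⟨
    deg (h a) * iₐ * F (h a)                     ≡⟨ cong (_* F (h a)) (deg*inv (h a)) ⟩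
    1ℚ * F (h a)                                 ≡⟨ *-identityˡ (F (h a)) ⟩
    F (h a)                                      ≡⟨ proj-entry a b ⟨
    proj a b                                     ∎
    where
    iₐ = inv (deg (h a))
    F : Fin k → ℚ
    F z = inv (deg z) * I z (h b)
    swap-assoc : ∀ x y z → x * y * z ≡ y * (x * z)
    swap-assoc = solve-∀ ℚ-ring

-- Orientable maps

module _ (X : OrientableMap) where
  open OrientableMap X

  vert-σ : ∀ a → vert (σ a) ≡ vert a
  vert-σ a = sym (Equivalence.from (vert-orbit a (σ a)) (1 , refl))

  face-σθ : ∀ a → face (σ (θ a)) ≡ face a
  face-σθ a = sym (Equivalence.from (face-orbit a (σ (θ a))) (1 , refl))

  vertex-face-invariant⇒constant : ∀ {A : Set} (y : Fin nA → A) →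
    (∀ a b → vert a ≡ vert b → y a ≡ y b) → (∀ a b → face a ≡ face b → y a ≡ y b) →
    ∀ a b → y a ≡ y b
  vertex-face-invariant⇒constant y y-vert y-face a b with connected a b
  ... | w , refl = sym (y-word w)
    where
    y-σ : ∀ a → y (σ a) ≡ y a
    y-σ a = y-vert (σ a) a (vert-σ a)
    y-θ : ∀ a → y (θ a) ≡ y a
    y-θ a = trans (sym (y-σ (θ a))) (y-face (σ (θ a)) a (face-σθ a))
    y-word : ∀ w → y (applyWord σ θ w a) ≡ y a
    y-word []          = refl
    y-word (true ∷ w)  = trans (y-σ (applyWord σ θ w a)) (y-word w)
    y-word (false ∷ w) = trans (y-θ (applyWord σ θ w a)) (y-word w)

module _ (X : OrientableMap) where
  open OrientableMap X
  open MapMatrices X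
  private
    module V = FibreProjection vert vert-surj
    module F = FibreProjection face face-surj

  PQ-entry : ∀ a b → (P · Q) a b ≡ inv (F.deg (face a)) * inv (V.deg (vert b)) * C (vert b) (face a)
  PQ-entry a b = begin
    sumF (λ l → P a l * Q l b)
      ≡⟨ sumF-cong (λ l → cong₂ _*_ (F.proj-entry a l) (trans (V.proj-sym l b) (V.proj-entry b l))) ⟩
    sumF (λ l → iF * I (face a) (face l) * (iV * I (vert b) (vert l)))
      ≡⟨ sumF-cong (λ l → trans (cong₂ (λ δ δ′ → iF * δ * (iV * δ′)) (I-sym (face a) (face l)) (I-sym (vert b) (vert l)))
                               (regroup iF (I (face l) (face a)) iV (I (vert l) (vert b)))) ⟩
    sumF (λ l → iF * iV * (I (vert l) (vert b) * I (face l) (face a)))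
      ≡⟨ *-distribˡ-sumF (iF * iV) (λ l → I (vert l) (vert b) * I (face l) (face a)) ⟨
    iF * iV * C (vert b) (face a)  ∎
    where
    iF = inv (F.deg (face a))
    iV = inv (V.deg (vert b))
    regroup : ∀ x δ y δ′ → x * δ * (y * δ′) ≡ x * y * (δ′ * δ)
    regroup = solve-∀ ℚ-ring

  QP≡PQᵀ : ∀ a b → (Q · P) a b ≡ (P · Q) b a
  QP≡PQᵀ a b = sumF-cong (λ l → trans (*-comm (Q a l) (P l b)) (cong₂ _*_ (F.proj-sym l b) (V.proj-sym a l)))

  comm⇒ii : P · Q ≋ Q · P → cond-ii
  comm⇒ii PQ≋QP a b = trans (*≡1⇒≡inv {ℕ→ℚ nA} nA*y≡1) (sym (*-identityʳ invA))
    where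
    y : Fin nA → ℚ
    y a = (P · Q) a b
    y-face : ∀ a a′ → face a ≡ face a′ → y a ≡ y a′
    y-face a a′ fa≡fa′ = begin
      y a                                                                ≡⟨ PQ-entry a b ⟩
      inv (F.deg (face a)) * inv (V.deg (vert b)) * C (vert b) (face a)  ≡⟨ cong (λ f → inv (F.deg f) * inv (V.deg (vert b)) * C (vert b) f) fa≡fa′ ⟩
      inv (F.deg (face a′)) * inv (V.deg (vert b)) * C (vert b) (face a′) ≡⟨ PQ-entry a′ b ⟨
      y a′                                                               ∎
    y-vert : ∀ a a′ → vert a ≡ vert a′ → y a ≡ y a′
    y-vert a a′ va≡va′ = begin
      y a                                                                ≡⟨ trans (PQ≋QP a b) (QP≡PQᵀ a b) ⟩
      (P · Q) b a                                                        ≡⟨ PQ-entry b a ⟩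
      inv (F.deg (face b)) * inv (V.deg (vert a)) * C (vert a) (face b)  ≡⟨ cong (λ v → inv (F.deg (face b)) * inv (V.deg v) * C v (face b)) va≡va′ ⟩
      inv (F.deg (face b)) * inv (V.deg (vert a′)) * C (vert a′) (face b) ≡⟨ PQ-entry b a′ ⟨
      (P · Q) b a′                                                       ≡⟨ trans (PQ≋QP a′ b) (QP≡PQᵀ a′ b) ⟨
      y a′                                                               ∎
    nA*y≡1 : ℕ→ℚ nA * y a ≡ 1ℚ
    nA*y≡1 = begin
      ℕ→ℚ nA * y a            ≡⟨ sumF-const {nA} (y a) ⟨
      sumF {nA} (λ _ → y a)   ≡⟨ sumF-cong (vertex-face-invariant⇒constant X y y-vert y-face a) ⟩
      sumF y                  ≡⟨ ·-colSum P Q F.proj-colSum b ⟩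
      sumF (λ l → Q l b)      ≡⟨ V.proj-colSum b ⟩
      1ℚ                      ∎

  ii⇒comm : cond-ii → P · Q ≋ Q · P
  ii⇒comm ii a b = trans (ii a b) (trans (sym (ii b a)) (sym (QP≡PQᵀ a b)))

  i⇔ii : cond-i ⇔ cond-ii
  i⇔ii = mk⇔ comm⇒ii ii⇒comm ⇔-∘ reflection-product-involutive⇔comm F.proj-idem V.proj-idem

  Balanced : Set
  Balanced = ∀ v f → C v f ≡ invA * (V.deg v * F.deg f)

  balanced⇒ii : Balanced → cond-ii
  balanced⇒ii balanced a b = begin
    (P · Q) a b                                 ≡⟨ PQ-entry a b ⟩
    iF * iV * C (vert b) (face a)               ≡⟨ cong (iF * iV *_) (balanced (vert b) (face a)) ⟩
    iF * iV * (invA * (dV * dF))                ≡⟨ regroup iF iV invA dV dF ⟩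
    invA * ((dF * iF) * (dV * iV))              ≡⟨ cong (invA *_) (cong₂ _*_ (F.deg*inv (face a)) (V.deg*inv (vert b))) ⟩
    invA * (1ℚ * 1ℚ)                            ≡⟨⟩
    invA * 1ℚ                                   ∎
    where
    dF = F.deg (face a)
    dV = V.deg (vert b)
    iF = inv dF
    iV = inv dV
    regroup : ∀ i j a d e → i * j * (a * (d * e)) ≡ a * ((e * i) * (d * j))
    regroup = solve-∀ ℚ-ring

  ii⇒balanced : cond-ii → Balanced
  ii⇒balanced ii v f with face-surj f | vert-surj v
  ... | a , refl | b , refl = begin
    C (vert b) (face a)                         ≡⟨ *-identityˡ (C (vert b) (face a)) ⟨
    1ℚ * 1ℚ * C (vert b) (face a)               ≡⟨ cong (_* C (vert b) (face a)) (cong₂ _*_ (F.deg*inv (face a)) (V.deg*inv (vert b))) ⟨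
    (dF * iF) * (dV * iV) * C (vert b) (face a) ≡⟨ regroup dF iF dV iV (C (vert b) (face a)) ⟩
    dF * dV * (iF * iV * C (vert b) (face a))   ≡⟨ cong (dF * dV *_) (trans (sym (PQ-entry a b)) (ii a b)) ⟩
    dF * dV * (invA * 1ℚ)                       ≡⟨ regroup′ dF dV invA ⟩
    invA * (dV * dF)                            ∎
    where
    dF = F.deg (face a)
    dV = V.deg (vert b)
    iF = inv dF
    iV = inv dV
    regroup : ∀ d i d′ i′ c → (d * i) * (d′ * i′) * c ≡ d * d′ * (i * i′ * c)
    regroup = solve-∀ ℚ-ring
    regroup′ : ∀ d d′ a → d * d′ * (a * 1ℚ) ≡ a * (d′ * d)
    regroup′ = solve-∀ ℚ-ring

  ii⇔balanced : cond-ii ⇔ Balanced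
  ii⇔balanced = mk⇔ ii⇒balanced balanced⇒ii

  DJΔ : ∀ v f → (D · Jm · Δ) v f ≡ V.deg v * F.deg f
  DJΔ v f = trans (·-cong (·-cong V.gram (λ _ _ → refl)) F.gram v f) (diag-·-Jm-·-diag V.deg F.deg v f)

  DJD : ∀ v w → (D · Jm · D) v w ≡ V.deg v * V.deg w
  DJD v w = trans (·-cong (·-cong V.gram (λ _ _ → refl)) V.gram v w) (diag-·-Jm-·-diag V.deg V.deg v w)

  iii⇔balanced : cond-iii ⇔ Balanced
  iii⇔balanced = mk⇔ (λ iii v f → trans (iii v f) (cong (invA *_) (DJΔ v f)))
                     (λ balanced v f → trans (balanced v f) (cong (invA *_) (sym (DJΔ v f))))

  C≡traversals : ∀ v f → C v f ≡ ℕ→ℚ (traversals v f)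
  C≡traversals v f = trans (sumF-cong (λ a → indicator-∧ ⌊ vert a ≟ᶠ v ⌋ ⌊ face a ≟ᶠ f ⌋))
                           (sumF-count (λ a → ⌊ vert a ≟ᶠ v ⌋ ∧ ⌊ face a ≟ᶠ f ⌋))

  v⇔balanced : cond-v ⇔ Balanced
  v⇔balanced = mk⇔
    (λ v-holds v f → trans (C≡traversals v f) (trans (v-holds v f) (*-assoc invA (V.deg v) (F.deg f))))
    (λ balanced v f → trans (sym (C≡traversals v f)) (trans (balanced v f) (sym (*-assoc invA (V.deg v) (F.deg f)))))

  C-rowSum : ∀ v → sumF (C v) ≡ V.deg v
  C-rowSum v = begin
    sumF (λ f → sumF (λ a → I (vert a) v * I (face a) f))  ≡⟨ sumF-comm (λ f a → I (vert a) v * I (face a) f) ⟩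
    sumF (λ a → sumF (λ f → I (vert a) v * I (face a) f))  ≡⟨ sumF-cong (λ a → *-distribˡ-sumF (I (vert a) v) (I (face a))) ⟨
    sumF (λ a → I (vert a) v * sumF (I (face a)))          ≡⟨ sumF-cong (λ a → trans (cong (I (vert a) v *_) (I-rowSum (face a))) (*-identityʳ (I (vert a) v))) ⟩
    sumF (λ a → I (vert a) v)                               ≡⟨ sumF-count (λ a → ⌊ vert a ≟ᶠ v ⌋) ⟩
    V.deg v                                                 ∎

  CΔCᵀ-entry : ∀ v w → (C · diagInv Δ · C ᵀ) v w ≡ sumF (λ f → C v f * inv (F.deg f) * C w f)
  CΔCᵀ-entry v w = sumF-cong (λ f → cong (_* C w f)
    (trans (·-cong {A = C} (λ _ _ → refl) (diagInv-diag {d = F.deg} F.gram) v f) (·-diagʳ C (inv ∘ F.deg) v f)))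

  invA*nA : Fin nV → invA * ℕ→ℚ nA ≡ 1ℚ
  invA*nA v = inv-inverseˡ (ℕ→ℚ-≢0 (proj₁ (vert-surj v)))

  balanced⇒iv : Balanced → cond-iv
  balanced⇒iv balanced v w = begin
    (C · diagInv Δ · C ᵀ) v w                         ≡⟨ CΔCᵀ-entry v w ⟩
    sumF (λ f → C v f * inv (F.deg f) * C w f)        ≡⟨ sumF-cong (λ f → cong₂ (λ x y → x * inv (F.deg f) * y) (balanced v f) (balanced w f)) ⟩
    sumF (λ f → invA * (dv * F.deg f) * inv (F.deg f) * (invA * (dw * F.deg f)))
      ≡⟨ sumF-cong (λ f → trans (regroup invA dv dw (F.deg f) (inv (F.deg f)))
                                (trans (cong (K * F.deg f *_) (F.deg*inv f)) (*-identityʳ (K * F.deg f)))) ⟩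
    sumF (λ f → K * F.deg f)                          ≡⟨ *-distribˡ-sumF K F.deg ⟨
    K * sumF F.deg                                    ≡⟨ cong (K *_) F.sumF-deg ⟩
    K * ℕ→ℚ nA                                        ≡⟨ regroup′ invA dv dw (ℕ→ℚ nA) ⟩
    invA * ℕ→ℚ nA * (invA * (dv * dw))                ≡⟨ cong (_* (invA * (dv * dw))) (invA*nA v) ⟩
    1ℚ * (invA * (dv * dw))                           ≡⟨ *-identityˡ (invA * (dv * dw)) ⟩
    invA * (dv * dw)                                  ≡⟨ cong (invA *_) (DJD v w) ⟨
    invA * (D · Jm · D) v w                           ∎
    where
    dv = V.deg v
    dw = V.deg w
    K = invA * invA * dv * dw
    regroup : ∀ a x y d i → a * (x * d) * i * (a * (y * d)) ≡ a * a * x * y * d * (d * i)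
    regroup = solve-∀ ℚ-ring
    regroup′ : ∀ a x y n → a * a * x * y * n ≡ a * n * (a * (x * y))
    regroup′ = solve-∀ ℚ-ring

  iv⇒balanced : cond-iv → Balanced
  iv⇒balanced iv v f = trans (sumF-square-tight⇒proportional (C v) F.deg (invA * dv) F.deg-pos Σx²/d≡cΣx cΣd≡Σx f)
                             (*-assoc invA dv (F.deg f))
    where
    dv = V.deg v
    Σx²/d≡cΣx : sumF (λ g → C v g * C v g * inv (F.deg g)) ≡ invA * dv * sumF (C v)
    Σx²/d≡cΣx = begin
      sumF (λ g → C v g * C v g * inv (F.deg g))  ≡⟨ sumF-cong (λ g → swap (C v g) (inv (F.deg g))) ⟩
      sumF (λ g → C v g * inv (F.deg g) * C v g)  ≡⟨ CΔCᵀ-entry v v ⟨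
      (C · diagInv Δ · C ᵀ) v v                   ≡⟨ iv v v ⟩
      invA * (D · Jm · D) v v                     ≡⟨ cong (invA *_) (DJD v v) ⟩
      invA * (dv * dv)                            ≡⟨ *-assoc invA dv dv ⟨
      invA * dv * dv                              ≡⟨ cong (invA * dv *_) (C-rowSum v) ⟨
      invA * dv * sumF (C v)                      ∎
      where
      swap : ∀ x i → x * x * i ≡ x * i * x
      swap = solve-∀ ℚ-ring
    cΣd≡Σx : invA * dv * sumF F.deg ≡ sumF (C v)
    cΣd≡Σx = begin
      invA * dv * sumF F.deg    ≡⟨ cong (invA * dv *_) F.sumF-deg ⟩
      invA * dv * ℕ→ℚ nA        ≡⟨ regroup invA dv (ℕ→ℚ nA) ⟩
      invA * ℕ→ℚ nA * dv        ≡⟨ cong (_* dv) (invA*nA v) ⟩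
      1ℚ * dv                   ≡⟨ *-identityˡ dv ⟩
      dv                        ≡⟨ C-rowSum v ⟨
      sumF (C v)                ∎
      where
      regroup : ∀ a d n → a * d * n ≡ a * n * d
      regroup = solve-∀ ℚ-ring

  iv⇔balanced : cond-iv ⇔ Balanced
  iv⇔balanced = mk⇔ iv⇒balanced balanced⇒iv

lemma6p2 : (X : OrientableMap) → let open MapMatrices X in
    (cond-i ⇔ cond-ii) × (cond-i ⇔ cond-iii) × (cond-i ⇔ cond-iv) × (cond-i ⇔ cond-v)
lemma6p2 X = i⇔ii X , via (iii⇔balanced X) , via (iv⇔balanced X) , via (v⇔balanced X)
  where
  open MapMatrices X using (cond-i)
  via : ∀ {A : Set} → A ⇔ Balanced X → cond-i ⇔ A
  via A⇔balanced = ⇔-sym A⇔balanced ⇔-∘ (ii⇔balanced X ⇔-∘ i⇔ii X)
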